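{- Let $n$ be an odd positive integer, let $p$ be the least prime divisor of $n$, and let $r \geq 2$ be an integer. Define \[ \beta(n,r) = (-1)^{\lfloor r/2 \rfloor} \binom{\frac{n-1}{2} - \lceil r/2 \rceil}{\lfloor r/2 \rfloor} - \binom{\frac{n-1}{2}}{r} (-2)^r , \] and let $\alpha(n,r)$ be the non-negative residue of $\beta(n,r)$ modulo $n$. Then $\alpha(n,r) \equiv 0 \pmod{n}$ if $r < p$, and $\alpha(n,r) \equiv n/p \pmod{n}$ if $r = p$.
   Context: $\lfloor a \rfloor$ denotes the greatest integer $\le a$ and $\lceil a \rceil$ the least integer $\ge a$. Binomial coefficients $\binom{m}{k}$ with integers $m, k \ge 0$ are the usual ones (equal to $0$ when $k > m$). The non-negative residue of an integer $b$ modulo $n$ is the unique integer $a$ with $0 \le a < n$ and $a \equiv b \pmod n$. -}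

module Defs where

open import Data.Nat as ℕ using (ℕ; suc; _∸_; _/_; ⌊_/2⌋; ⌈_/2⌉)
open import Data.Nat.Combinatorics using (_C_)
open import Data.Integer as ℤ using (ℤ; +_; -_)
open import Data.Integer.DivMod using (_%ℕ_)

sgn : ℕ → ℤ
sgn ℕ.zero = + 1
sgn (suc k) = - sgn k

infixr 8 _^ℤ_
_^ℤ_ : ℤ → ℕ → ℤ
x ^ℤ ℕ.zero = + 1
x ^ℤ suc k = x ℤ.* (x ^ℤ k)

-- generalized binomial coefficient x(x-1)...(x-k+1)/k! with integer top x:
-- for x = -(a+1) < 0 it equals (-1)^k * C(a+k, k).
Cℤ : ℤ → ℕ → ℤ
Cℤ (+ a) k = + (a C k)
Cℤ ℤ.-[1+ a ] k = sgn k ℤ.* (+ ((k ℕ.+ a) C k))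

-- β(n,r) where n = 2m+1, so (n-1)/2 = m; the top (n-1)/2 - ⌈r/2⌉ is an integer.
β : (m r : ℕ) → ℤ
β m r = sgn ⌊ r /2⌋ ℤ.* Cℤ (+ m ℤ.- + ⌈ r /2⌉) ⌊ r /2⌋
        ℤ.- (+ (m C r)) ℤ.* ((- (+ 2)) ^ℤ r)

α : (m r : ℕ) → ℕ
α m r = β m r %ℕ suc (2 ℕ.* m)

{-# OPTIONS --safe #-}
-- Write n = 2m+1, c = ⌈r/2⌉, k = ⌊r/2⌋ and h j = (2j+1) − n = −2(m−j).  Splitting r! into its odd
-- and even factors, r! = (1·3⋯(2c−1))·(2·4⋯2k), and expanding both binomial coefficients of β as
-- falling factorials gives the integer identity
--     r! · β(n,r) = (∏_{j<c} (2j+1) − ∏_{j<c} h j) · ∏_{i<k} h (c+i).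
-- As h j ≡ 2j+1 (mod n), the right-hand side is divisible by n; for r < p the factor r! is prime
-- to n, so β ≡ 0.  For r = p = 2k+1 and n = pq the two products over j < k+1 end in the factors p
-- and p − n; modulo p the remaining factors h j and h (k+1+i) become 2j+1 and 2(i+1), whose
-- product is (p−1)!.  This yields (p−1)!·β ≡ (p−1)!·q (mod n), hence β ≡ q = n/p.
module Submission where

open import Defs
open import Data.Nat as ℕ using (ℕ; zero; suc; _!; ⌊_/2⌋; ⌈_/2⌉)
import Data.Nat.Properties as ℕₚ
import Data.Nat.Divisibility as ℕ∣
open import Data.Nat.Combinatorics using (_C_; nCk+nC[k+1]≡[n+1]C[k+1])
open import Data.Nat.Coprimality using (Coprime)
open import Data.Empty using (⊥-elim)
open import Relation.Binary.PropositionalEquality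

module _ where
  open import Data.Integer using (ℤ; NonZero; +_; -_; -[1+_]; _+_; _*_; _-_; ∣_∣; _%ℕ_; _/ℕ_)
  open import Data.Integer.Properties as ℤₚ using (pos-*; pos-+)
  open import Data.Integer.DivMod using (n%ℕd<d; a≡a%ℕn+[a/ℕn]*n)
  open import Data.Integer.Divisibility.Signed
    using ( _∣_; divides; ∣-refl; ∣m∣n⇒∣m+n; ∣m∣n⇒∣m-n; ∣m⇒∣m*n; ∣n⇒∣m*n; ∣m⇒∣-m
          ; *-monoʳ-∣; *-cancelˡ-∣; ∣⇒∣ᵤ; ∣ᵤ⇒∣)
  import Data.Integer.Coprimality as ℤ
  open import Algebra.Properties.CommutativeSemigroup ℤₚ.*-commutativeSemigroup using (interchange; x∙yz≈y∙xz)
  open import Data.Integer.Tactic.RingSolver using (solve-∀)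
  open ≡-Reasoning

  ∏ : ℕ → (ℕ → ℤ) → ℤ
  ∏ zero    f = + 1
  ∏ (suc k) f = f k * ∏ k f

  syntax ∏ k (λ i → e) = ∏[ i < k ] e

  ∏-cong : ∀ k {f g : ℕ → ℤ} → (∀ i → f i ≡ g i) → ∏ k f ≡ ∏ k g
  ∏-cong zero    f≡g = refl
  ∏-cong (suc k) f≡g = cong₂ _*_ (f≡g k) (∏-cong k f≡g)

  ∏-+ : ∀ a b (f : ℕ → ℤ) → ∏ (a ℕ.+ b) f ≡ ∏[ i < b ] f (a ℕ.+ i) * ∏ a f
  ∏-+ a zero    f = trans (cong (λ n → ∏ n f) (ℕₚ.+-identityʳ a)) (sym (ℤₚ.*-identityˡ (∏ a f)))
  ∏-+ a (suc b) f = begin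
    ∏ (a ℕ.+ suc b) f                               ≡⟨ cong (λ n → ∏ n f) (ℕₚ.+-suc a b) ⟩
    f (a ℕ.+ b) * ∏ (a ℕ.+ b) f                     ≡⟨ cong (f (a ℕ.+ b) *_) (∏-+ a b f) ⟩
    f (a ℕ.+ b) * (∏[ i < b ] f (a ℕ.+ i) * ∏ a f)   ≡⟨ ℤₚ.*-assoc (f (a ℕ.+ b)) _ _ ⟨
    f (a ℕ.+ b) * ∏[ i < b ] f (a ℕ.+ i) * ∏ a f     ∎

  ∏-*ˡ : ∀ k x (f : ℕ → ℤ) → ∏[ i < k ] (x * f i) ≡ x ^ℤ k * ∏ k f
  ∏-*ˡ zero    x f = refl
  ∏-*ˡ (suc k) x f = trans (cong (x * f k *_) (∏-*ˡ k x f)) (interchange x (f k) (x ^ℤ k) (∏ k f))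

  ∏[1+i]≡! : ∀ k → ∏[ i < k ] (+ suc i) ≡ + (k !)
  ∏[1+i]≡! zero    = refl
  ∏[1+i]≡! (suc k) = trans (cong (+ suc k *_) (∏[1+i]≡! k)) (sym (pos-* (suc k) (k !)))

  -- A record rather than a synonym for n ∣ a - b, so that a and b can be inferred from the type.
  infix 4 _≡_mod_
  record _≡_mod_ (a b n : ℤ) : Set where
    constructor by-divisibility
    field divisibility : n ∣ a - b
  open _≡_mod_ using (divisibility)

  ≡-mod-sym : ∀ {n a b} → a ≡ b mod n → b ≡ a mod n
  ≡-mod-sym {n} {a} {b} (by-divisibility n∣a-b) =
    by-divisibility (subst (n ∣_) (negate-difference a b) (∣m⇒∣-m n∣a-b))
    where
    negate-difference : ∀ a b → - (a - b) ≡ b - a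
    negate-difference = solve-∀

  *-cong-mod : ∀ {n a b c d} → a ≡ b mod n → c ≡ d mod n → a * c ≡ b * d mod n
  *-cong-mod {n} {a} {b} {c} {d} (by-divisibility n∣a-b) (by-divisibility n∣c-d) = by-divisibility
    (subst (n ∣_) (sym (product-difference a b c d))
      (∣m∣n⇒∣m+n (∣m⇒∣m*n c n∣a-b) (∣n⇒∣m*n b n∣c-d)))
    where
    product-difference : ∀ a b c d → a * c - b * d ≡ (a - b) * c + b * (c - d)
    product-difference = solve-∀

  ∏-cong-mod : ∀ {n} k {f g : ℕ → ℤ} → (∀ i → f i ≡ g i mod n) → ∏ k f ≡ ∏ k g mod n
  ∏-cong-mod zero    f≡g = by-divisibility (divides (+ 0) refl)
  ∏-cong-mod (suc k) f≡g = *-cong-mod (f≡g k) (∏-cong-mod k f≡g)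

  sub-multiple-≡ : ∀ {d n} x → d ∣ n → x - n ≡ x mod d
  sub-multiple-≡ {d} {n} x d∣n = by-divisibility (subst (d ∣_) (sym (difference x n)) (∣m⇒∣-m d∣n))
    where
    difference : ∀ x n → x - n - x ≡ - n
    difference = solve-∀

  ≡-mod-cancelˡ : ∀ {n} a {x y} → ℤ.Coprime n a → a * x ≡ a * y mod n → x ≡ y mod n
  ≡-mod-cancelˡ {n} a {x} {y} n⊥a (by-divisibility n∣ax-ay) = by-divisibility (∣ᵤ⇒∣
    (ℤ.coprime-divisor n a (x - y) n⊥a (∣⇒∣ᵤ (subst (n ∣_) (factor-out a x y) n∣ax-ay))))
    where
    factor-out : ∀ a x y → a * x - a * y ≡ a * (x - y)
    factor-out = solve-∀

  residues-unique : ∀ {n a b} → a ℕ.< n → b ℕ.< n → + a ≡ + b mod + n → a ≡ b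
  residues-unique {n} {a} {b} a<n b<n (by-divisibility n∣a-b)
    with ∣ + a - + b ∣ in distance | ∣⇒∣ᵤ n∣a-b
  ... | zero  | _     = ℤₚ.+-injective (ℤₚ.i-j≡0⇒i≡j (+ a) (+ b) (ℤₚ.∣i∣≡0⇒i≡0 distance))
  ... | suc d | n∣1+d = ⊥-elim (ℕₚ.<⇒≱ (distance<n distance) (ℕ∣.∣⇒≤ n∣1+d))
    where
    distance<n : ∀ {d} → ∣ + a - + b ∣ ≡ d → d ℕ.< n
    distance<n refl = ℕₚ.≤-<-trans
      (subst (ℕ._≤ a ℕ.⊔ b) (cong ∣_∣ (sym (ℤₚ.m-n≡m⊖n a b))) (ℤₚ.∣m⊝n∣≤m⊔n a b))
      (ℕₚ.⊔-lub a<n b<n)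

  ≡-mod⇒%ℕ≡ : ∀ {n} .{{_ : ℕ.NonZero n}} {b q} → q ℕ.< n → b ≡ + q mod + n → b %ℕ n ≡ q
  ≡-mod⇒%ℕ≡ {n} {b = b} {q} q<n (by-divisibility n∣b-q) = residues-unique (n%ℕd<d b n) q<n
    (by-divisibility (subst (+ n ∣_) (sym (remove-multiple (+ (b %ℕ n)) (b /ℕ n) (a≡a%ℕn+[a/ℕn]*n b n)))
      (∣m∣n⇒∣m-n n∣b-q (∣n⇒∣m*n (b /ℕ n) ∣-refl))))
    where
    remove-multiple : ∀ {b} r t → b ≡ r + t * + n → r - + q ≡ b - + q - t * + n
    remove-multiple r t refl = rearrange r t (+ n) (+ q)
      where
      rearrange : ∀ r t n q → r - q ≡ r + t * n - q - t * n
      rearrange = solve-∀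

  fall : ℤ → ℕ → ℤ
  fall x k = ∏[ i < k ] (x - + i)

  fall-suc : ∀ x k → fall (+ 1 + x) (suc k) ≡ (+ 1 + x) * fall x k
  fall-suc x zero    = first-factor x
    where
    first-factor : ∀ x → (+ 1 + x - + 0) * + 1 ≡ (+ 1 + x) * + 1
    first-factor = solve-∀
  fall-suc x (suc k) = begin
    (+ 1 + x - + suc k) * fall (+ 1 + x) (suc k)      ≡⟨ cong ((+ 1 + x - + suc k) *_) (fall-suc x k) ⟩
    (+ 1 + x - (+ 1 + + k)) * ((+ 1 + x) * fall x k)  ≡⟨ shift x (+ k) (fall x k) ⟩
    (+ 1 + x) * ((x - + k) * fall x k)                ∎
    where
    shift : ∀ x k f → (+ 1 + x - (+ 1 + k)) * ((+ 1 + x) * f) ≡ (+ 1 + x) * ((x - k) * f)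
    shift = solve-∀

  fall-0 : ∀ k → fall (+ 0) (suc k) ≡ + 0
  fall-0 zero    = refl
  fall-0 (suc k) = trans (cong ((+ 0 - + suc k) *_) (fall-0 k)) (ℤₚ.*-zeroʳ (+ 0 - + suc k))

  k!*C≡fall : ∀ n k → + (k !) * + (n C k) ≡ fall (+ n) k
  k!*C≡fall n       zero    = ℤₚ.*-identityˡ (+ 1)
  k!*C≡fall zero    (suc k) = trans (ℤₚ.*-zeroʳ (+ (suc k !))) (sym (fall-0 k))
  k!*C≡fall (suc n) (suc k) = begin
    + (suc k !) * + (suc n C suc k)
      ≡⟨ cong (λ c → + (suc k !) * + c) (nCk+nC[k+1]≡[n+1]C[k+1] n k) ⟨
    + (suc k !) * + (n C k ℕ.+ n C suc k)
      ≡⟨ cong₂ _*_ (pos-* (suc k) (k !)) (pos-+ (n C k) (n C suc k)) ⟩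
    + suc k * + (k !) * (+ (n C k) + + (n C suc k))
      ≡⟨ split (+ suc k) (+ (k !)) (+ (n C k)) (+ (n C suc k)) ⟩
    + suc k * (+ (k !) * + (n C k)) + + suc k * + (k !) * + (n C suc k)
      ≡⟨ cong₂ (λ f g → + suc k * f + g * + (n C suc k)) (k!*C≡fall n k) (sym (pos-* (suc k) (k !))) ⟩
    + suc k * fall (+ n) k + + (suc k !) * + (n C suc k)
      ≡⟨ cong (λ g → + suc k * fall (+ n) k + g) (k!*C≡fall n (suc k)) ⟩
    + suc k * fall (+ n) k + (+ n - + k) * fall (+ n) k
      ≡⟨ collect (+ n) (+ k) (fall (+ n) k) ⟩
    (+ 1 + + n) * fall (+ n) k
      ≡⟨ fall-suc (+ n) k ⟨
    fall (+ suc n) (suc k) ∎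
    where
    split : ∀ a b c d → a * b * (c + d) ≡ a * (b * c) + a * b * d
    split = solve-∀
    collect : ∀ n k f → (+ 1 + k) * f + (n - k) * f ≡ (+ 1 + n) * f
    collect = solve-∀

  fall-neg : ∀ a k → fall -[1+ a ] k ≡ sgn k * fall (+ (k ℕ.+ a)) k
  fall-neg a zero    = refl
  fall-neg a (suc k) = begin
    (-[1+ a ] - + k) * fall -[1+ a ] k
      ≡⟨ cong ((-[1+ a ] - + k) *_) (fall-neg a k) ⟩
    (- (+ 1 + + a) - + k) * (sgn k * fall (+ (k ℕ.+ a)) k)
      ≡⟨ reflect (+ a) (+ k) (sgn k) (fall (+ (k ℕ.+ a)) k) ⟩
    - sgn k * ((+ 1 + (+ k + + a)) * fall (+ (k ℕ.+ a)) k)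
      ≡⟨ cong (- sgn k *_) (fall-suc (+ (k ℕ.+ a)) k) ⟨
    - sgn k * fall (+ (suc k ℕ.+ a)) (suc k) ∎
    where
    reflect : ∀ a k s f → (- (+ 1 + a) - k) * (s * f) ≡ - s * ((+ 1 + (k + a)) * f)
    reflect = solve-∀

  k!*Cℤ≡fall : ∀ x k → + (k !) * Cℤ x k ≡ fall x k
  k!*Cℤ≡fall (+ n)    k = k!*C≡fall n k
  k!*Cℤ≡fall -[1+ a ] k = begin
    + (k !) * (sgn k * + ((k ℕ.+ a) C k))  ≡⟨ x∙yz≈y∙xz (+ (k !)) (sgn k) _ ⟩
    sgn k * (+ (k !) * + ((k ℕ.+ a) C k))  ≡⟨ cong (sgn k *_) (k!*C≡fall (k ℕ.+ a) k) ⟩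
    sgn k * fall (+ (k ℕ.+ a)) k           ≡⟨ fall-neg a k ⟨
    fall -[1+ a ] k                        ∎

  oddℤ : ℕ → ℤ
  oddℤ j = + 2 * + j + + 1

  oddℤ≡+[1+2j] : ∀ j → oddℤ j ≡ + suc (2 ℕ.* j)
  oddℤ≡+[1+2j] j = trans (cong (_+ + 1) (sym (pos-* 2 j))) (cong +_ (ℕₚ.+-comm (2 ℕ.* j) 1))

  odds evens : ℕ → ℤ
  odds  k = ∏[ j < k ] oddℤ j
  evens k = ∏[ i < k ] (+ 2 * + suc i)

  evens≡2^k*k! : ∀ k → evens k ≡ (+ 2) ^ℤ k * + (k !)
  evens≡2^k*k! k = trans (∏-*ˡ k (+ 2) (λ i → + suc i)) (cong ((+ 2) ^ℤ k *_) (∏[1+i]≡! k))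

  factorial-even : ∀ k → + ((2 ℕ.* k) !) ≡ odds k * evens k
  factorial-odd  : ∀ k → + (suc (2 ℕ.* k) !) ≡ odds (suc k) * evens k

  factorial-even zero    = refl
  factorial-even (suc k) = begin
    + ((2 ℕ.* suc k) !)                        ≡⟨ cong (λ r → + (r !)) (ℕₚ.*-suc 2 k) ⟩
    + ((2 ℕ.+ 2 ℕ.* k) ℕ.* suc (2 ℕ.* k) !)    ≡⟨ pos-* (2 ℕ.+ 2 ℕ.* k) (suc (2 ℕ.* k) !) ⟩
    + (2 ℕ.+ 2 ℕ.* k) * + (suc (2 ℕ.* k) !)    ≡⟨ cong₂ _*_ 2+2k≡2*[1+k] (factorial-odd k) ⟩
    + 2 * + suc k * (odds (suc k) * evens k)   ≡⟨ x∙yz≈y∙xz (+ 2 * + suc k) (odds (suc k)) (evens k) ⟩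
    odds (suc k) * evens (suc k)               ∎
    where
    2+2k≡2*[1+k] : + (2 ℕ.+ 2 ℕ.* k) ≡ + 2 * + suc k
    2+2k≡2*[1+k] = trans (cong +_ (sym (ℕₚ.*-suc 2 k))) (pos-* 2 (suc k))
  factorial-odd k = begin
    + (suc (2 ℕ.* k) !)                  ≡⟨ pos-* (suc (2 ℕ.* k)) ((2 ℕ.* k) !) ⟩
    + suc (2 ℕ.* k) * + ((2 ℕ.* k) !)    ≡⟨ cong₂ _*_ (sym (oddℤ≡+[1+2j] k)) (factorial-even k) ⟩
    oddℤ k * (odds k * evens k)          ≡⟨ ℤₚ.*-assoc (oddℤ k) _ _ ⟨
    odds (suc k) * evens k               ∎

  data Halves : ℕ → ℕ → ℕ → Set where
    even : ∀ k → Halves (2 ℕ.* k) k k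
    odd  : ∀ k → Halves (suc (2 ℕ.* k)) (suc k) k

  halving : ∀ r → Halves r ⌈ r /2⌉ ⌊ r /2⌋
  halving zero          = even 0
  halving (suc zero)    = odd 0
  halving (suc (suc r)) = next (halving r)
    where
    next : ∀ {r c k} → Halves r c k → Halves (2 ℕ.+ r) (suc c) (suc k)
    next (even k) = subst (λ r → Halves r (suc k) (suc k)) (ℕₚ.*-suc 2 k) (even (suc k))
    next (odd k)  = subst (λ r → Halves r (suc (suc k)) (suc k)) (cong suc (ℕₚ.*-suc 2 k)) (odd (suc k))

  halves-sum : ∀ {r c k} → Halves r c k → r ≡ c ℕ.+ k
  halves-sum (even k) = cong (k ℕ.+_) (ℕₚ.+-identityʳ k)
  halves-sum (odd k)  = cong (λ x → suc (k ℕ.+ x)) (ℕₚ.+-identityʳ k)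

  factorial-halves : ∀ {r c k} → Halves r c k → + (r !) ≡ odds c * evens k
  factorial-halves (even k) = factorial-even k
  factorial-halves (odd k)  = factorial-odd k

  2^k*sgn≡[-2]^k : ∀ k → (+ 2) ^ℤ k * sgn k ≡ (- + 2) ^ℤ k
  2^k*sgn≡[-2]^k zero    = refl
  2^k*sgn≡[-2]^k (suc k) = trans (move-sign ((+ 2) ^ℤ k) (sgn k)) (cong (- + 2 *_) (2^k*sgn≡[-2]^k k))
    where
    move-sign : ∀ a s → + 2 * a * - s ≡ - + 2 * (a * s)
    move-sign = solve-∀

  evens*sgn*Cℤ≡[-2]^k*fall : ∀ x k → evens k * (sgn k * Cℤ x k) ≡ (- + 2) ^ℤ k * fall x k
  evens*sgn*Cℤ≡[-2]^k*fall x k = begin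
    evens k * (sgn k * Cℤ x k)               ≡⟨ cong (_* (sgn k * Cℤ x k)) (evens≡2^k*k! k) ⟩
    (+ 2) ^ℤ k * + (k !) * (sgn k * Cℤ x k)  ≡⟨ interchange ((+ 2) ^ℤ k) (+ (k !)) (sgn k) (Cℤ x k) ⟩
    (+ 2) ^ℤ k * sgn k * (+ (k !) * Cℤ x k)  ≡⟨ cong₂ _*_ (2^k*sgn≡[-2]^k k) (k!*Cℤ≡fall x k) ⟩
    (- + 2) ^ℤ k * fall x k                  ∎

  [-2]^k*fall≡∏odd : ∀ x c k →
    (- + 2) ^ℤ k * fall (x - + c) k ≡ ∏[ i < k ] (oddℤ (c ℕ.+ i) - (+ 2 * x + + 1))
  [-2]^k*fall≡∏odd x c k = trans (sym (∏-*ˡ k (- + 2) (λ i → x - + c - + i)))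
    (∏-cong k (λ i → double x (+ c) (+ i)))
    where
    double : ∀ x c i → - + 2 * (x - c - i) ≡ + 2 * (c + i) + + 1 - (+ 2 * x + + 1)
    double = solve-∀

  r!*β≡ : ∀ m r → let c = ⌈ r /2⌉; k = ⌊ r /2⌋ in
    + (r !) * β m r ≡ (odds c - ∏[ j < c ] (oddℤ j - oddℤ m)) * ∏[ i < k ] (oddℤ (c ℕ.+ i) - oddℤ m)
  r!*β≡ m r = begin
    + (r !) * β m r
      ≡⟨ distribute (+ (r !)) (sgn k) (Cℤ x k) (+ (m C r)) ((- + 2) ^ℤ r) ⟩
    + (r !) * (sgn k * Cℤ x k) - (- + 2) ^ℤ r * (+ (r !) * + (m C r))
      ≡⟨ cong₂ (λ f g → f * (sgn k * Cℤ x k) - (- + 2) ^ℤ r * g)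
               (factorial-halves (halving r)) (k!*C≡fall m r) ⟩
    odds c * evens k * (sgn k * Cℤ x k) - (- + 2) ^ℤ r * fall (+ m) r
      ≡⟨ cong₂ (λ f y → f - (- + 2) ^ℤ r * fall y r) first-term (sym (ℤₚ.+-identityʳ (+ m))) ⟩
    odds c * ((- + 2) ^ℤ k * fall x k) - (- + 2) ^ℤ r * fall (+ m - + 0) r
      ≡⟨ cong₂ (λ f g → odds c * f - g) ([-2]^k*fall≡∏odd (+ m) c k) ([-2]^k*fall≡∏odd (+ m) 0 r) ⟩
    odds c * Q - ∏ r h
      ≡⟨ cong (λ n → odds c * Q - ∏ n h) (halves-sum (halving r)) ⟩
    odds c * Q - ∏ (c ℕ.+ k) h
      ≡⟨ cong (λ g → odds c * Q - g) (∏-+ c k h) ⟩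
    odds c * Q - Q * ∏ c h
      ≡⟨ factor (odds c) Q (∏ c h) ⟩
    (odds c - ∏ c h) * Q ∎
    where
    c k : ℕ
    c = ⌈ r /2⌉
    k = ⌊ r /2⌋
    h : ℕ → ℤ
    h j = oddℤ j - oddℤ m
    x Q : ℤ
    x = + m - + c
    Q = ∏[ i < k ] h (c ℕ.+ i)
    first-term : odds c * evens k * (sgn k * Cℤ x k) ≡ odds c * ((- + 2) ^ℤ k * fall x k)
    first-term = trans (ℤₚ.*-assoc (odds c) _ _) (cong (odds c *_) (evens*sgn*Cℤ≡[-2]^k*fall x k))
    distribute : ∀ f s b d w → f * (s * b - d * w) ≡ f * (s * b) - w * (f * d)
    distribute = solve-∀
    factor : ∀ o q p → o * q - q * p ≡ (o - p) * q
    factor = solve-∀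

  odds≡shifted : ∀ m c → odds c ≡ ∏[ j < c ] (oddℤ j - oddℤ m) mod oddℤ m
  odds≡shifted m c = ∏-cong-mod c (λ j → ≡-mod-sym (sub-multiple-≡ (oddℤ j) ∣-refl))

  β≡0 : ∀ m r → Coprime (suc (2 ℕ.* m)) (r !) → β m r ≡ + 0 mod + suc (2 ℕ.* m)
  β≡0 m r n⊥r! = ≡-mod-cancelˡ (+ (r !)) n⊥r!
    (subst (λ n → + (r !) * β m r ≡ + (r !) * + 0 mod n) (oddℤ≡+[1+2j] m) (by-divisibility
      (subst (oddℤ m ∣_) (sym (trans (drop-zero (+ (r !) * β m r) (+ (r !))) (r!*β≡ m r)))
        (∣m⇒∣m*n _ (divisibility (odds≡shifted m ⌈ r /2⌉))))))
    where
    drop-zero : ∀ a b → a - b * + 0 ≡ a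
    drop-zero = solve-∀

  shifted-odds≡factorial : ∀ k {n} → oddℤ k ∣ n →
    ∏[ j < k ] (oddℤ j - n) * ∏[ i < k ] (oddℤ (suc k ℕ.+ i) - n) ≡ + ((2 ℕ.* k) !) mod oddℤ k
  shifted-odds≡factorial k {n} p∣n = subst (λ f → lower * upper ≡ f mod oddℤ k) (sym (factorial-even k))
    (*-cong-mod (∏-cong-mod k (λ j → sub-multiple-≡ (oddℤ j) p∣n)) (∏-cong-mod k upper≡even))
    where
    lower upper : ℤ
    lower = ∏[ j < k ] (oddℤ j - n)
    upper = ∏[ i < k ] (oddℤ (suc k ℕ.+ i) - n)
    upper≡even : ∀ i → oddℤ (suc k ℕ.+ i) - n ≡ + 2 * + suc i mod oddℤ k
    upper≡even i = by-divisibility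
      (subst (oddℤ k ∣_) (sym (difference (+ k) (+ i) n)) (∣m∣n⇒∣m-n ∣-refl p∣n))
      where
      difference : ∀ k i n → + 2 * (+ 1 + (k + i)) + + 1 - n - + 2 * (+ 1 + i) ≡ + 2 * k + + 1 - n
      difference = solve-∀

  cofactor-congruence : ∀ m k q (b : ℤ) → oddℤ m ≡ oddℤ k * + q →
    + (suc (2 ℕ.* k) !) * b
      ≡ (odds (suc k) - ∏[ j < suc k ] (oddℤ j - oddℤ m)) * ∏[ i < k ] (oddℤ (suc k ℕ.+ i) - oddℤ m) →
    + ((2 ℕ.* k) !) * b ≡ + ((2 ℕ.* k) !) * + q mod oddℤ m
  cofactor-congruence m k q b n≡pq factorisation = by-divisibility (*-cancelˡ-∣ p {{p≢0}} p*n∣p*[Fb-Fq])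
    where
    p n F O H Q : ℤ
    p = oddℤ k
    n = oddℤ m
    F = + ((2 ℕ.* k) !)
    O = odds k
    H = ∏[ j < k ] (oddℤ j - n)
    Q = ∏[ i < k ] (oddℤ (suc k ℕ.+ i) - n)
    p≢0 : NonZero p
    p≢0 = subst NonZero (sym (oddℤ≡+[1+2j] k)) _
    p*F*b≡ : p * F * b ≡ (p * O - (p - n) * H) * Q
    p*F*b≡ = trans (cong (_* b) p*F≡p!) factorisation
      where
      p*F≡p! : p * F ≡ + (suc (2 ℕ.* k) !)
      p*F≡p! = trans (cong (_* F) (oddℤ≡+[1+2j] k)) (sym (pos-* (suc (2 ℕ.* k)) ((2 ℕ.* k) !)))
    expand : p * (F * b - F * + q) ≡ p * (O - H) * Q + n * (H * Q - F)
    expand = begin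
      p * (F * b - F * + q)              ≡⟨ distribute p F b (+ q) ⟩
      p * F * b - p * + q * F            ≡⟨ cong₂ _-_ p*F*b≡ (cong (_* F) (sym n≡pq)) ⟩
      (p * O - (p - n) * H) * Q - n * F  ≡⟨ regroup p O n H Q F ⟩
      p * (O - H) * Q + n * (H * Q - F)  ∎
      where
      distribute : ∀ p f b q → p * (f * b - f * q) ≡ p * f * b - p * q * f
      distribute = solve-∀
      regroup : ∀ p o n h q f → (p * o - (p - n) * h) * q - n * f ≡ p * (o - h) * q + n * (h * q - f)
      regroup = solve-∀
    p∣HQ-F : p ∣ H * Q - F
    p∣HQ-F = divisibility (shifted-odds≡factorial k (divides (+ q) (trans n≡pq (ℤₚ.*-comm p (+ q)))))
    p*n∣p*[Fb-Fq] : p * n ∣ p * (F * b - F * + q)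
    p*n∣p*[Fb-Fq] = subst (p * n ∣_) (sym expand) (∣m∣n⇒∣m+n
      (∣m⇒∣m*n Q (*-monoʳ-∣ p (divisibility (odds≡shifted m k))))
      (subst (_∣ n * (H * Q - F)) (ℤₚ.*-comm n p) (*-monoʳ-∣ n p∣HQ-F)))

  factorised≡cofactor : ∀ m q {p c k} (b : ℤ) → Halves p c k →
    p ℕ.* q ≡ suc (2 ℕ.* m) → Coprime (suc (2 ℕ.* m)) (ℕ.pred p !) →
    + (p !) * b ≡ (odds c - ∏[ j < c ] (oddℤ j - oddℤ m)) * ∏[ i < k ] (oddℤ (c ℕ.+ i) - oddℤ m) →
    b ≡ + q mod + suc (2 ℕ.* m)
  factorised≡cofactor m q b (even k) pq≡n _ _ =
    ⊥-elim (ℕₚ.even≢odd (k ℕ.* q) m (trans (sym (ℕₚ.*-assoc 2 k q)) pq≡n))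
  factorised≡cofactor m q b (odd k) pq≡n n⊥[p-1]! factorisation = ≡-mod-cancelˡ (+ ((2 ℕ.* k) !)) n⊥[p-1]!
    (subst (λ n → + ((2 ℕ.* k) !) * b ≡ + ((2 ℕ.* k) !) * + q mod n) (oddℤ≡+[1+2j] m)
      (cofactor-congruence m k q b n≡pq factorisation))
    where
    n≡pq : oddℤ m ≡ oddℤ k * + q
    n≡pq = begin
      oddℤ m                      ≡⟨ oddℤ≡+[1+2j] m ⟩
      + suc (2 ℕ.* m)             ≡⟨ cong +_ pq≡n ⟨
      + (suc (2 ℕ.* k) ℕ.* q)     ≡⟨ pos-* (suc (2 ℕ.* k)) q ⟩
      + suc (2 ℕ.* k) * + q       ≡⟨ cong (_* + q) (oddℤ≡+[1+2j] k) ⟨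
      oddℤ k * + q                ∎

  β≡cofactor : ∀ m p q → p ℕ.* q ≡ suc (2 ℕ.* m) → Coprime (suc (2 ℕ.* m)) (ℕ.pred p !) →
    β m p ≡ + q mod + suc (2 ℕ.* m)
  β≡cofactor m p q pq≡n n⊥[p-1]! = factorised≡cofactor m q (β m p) (halving p) pq≡n n⊥[p-1]! (r!*β≡ m p)

open import Data.Nat using (_*_; _<_; _≤_; _%_; s≤s; z≤n)
open ℕ∣ using (_∣_; ∣-trans; 0∣⇒≡0; ∣⇒≤; ∣1⇒≡1)
open import Data.Nat.Divisibility.Core using (hasNonTrivialDivisor)
open import Data.Nat.Coprimality using (coprime-divisor)
open import Data.Nat.Primality
  using ( Prime; _Rough_; 0-rough; 1-rough; 2-rough; ∤⇒rough-suc; rough∧∣⇒prime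
        ; prime⇒nonZero; prime⇒nonTrivial)
open import Data.Product using (_×_; _,_)

coprime-* : ∀ {n a b} → Coprime n a → Coprime n b → Coprime n (a * b)
coprime-* n⊥a n⊥b (i∣n , i∣ab) =
  n⊥b (i∣n , coprime-divisor (λ (j∣i , j∣a) → n⊥a (∣-trans j∣i i∣n , j∣a)) i∣ab)

module _ {n p : ℕ} (p≤prime-divisors : ∀ q → Prime q → q ∣ n → p ≤ q) where

  rough-below : ∀ j → j ≤ p → j Rough n
  rough-below zero                _     = 0-rough
  rough-below (suc zero)          _     = 1-rough
  rough-below (suc (suc zero))    _     = 2-rough
  rough-below (suc (suc (suc j))) 3+j≤p =
    extend (rough-below (suc (suc j)) (ℕₚ.≤-trans (ℕₚ.n≤1+n _) 3+j≤p))
    where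
    extend : suc (suc j) Rough n → suc (suc (suc j)) Rough n
    extend rough =
      ∤⇒rough-suc (λ d∣n → ℕₚ.<⇒≱ 3+j≤p (p≤prime-divisors _ (rough∧∣⇒prime rough d∣n) d∣n)) rough

  coprime-below : ∀ {d} → 0 < d → d < p → Coprime n d
  coprime-below 0<d d<p {zero}        (_ , 0∣d)   = ⊥-elim (ℕₚ.<⇒≢ 0<d (sym (0∣⇒≡0 0∣d)))
  coprime-below 0<d d<p {suc zero}    _           = refl
  coprime-below 0<d d<p {suc (suc i)} (i∣n , i∣d) = ⊥-elim
    (rough-below p ℕₚ.≤-refl (hasNonTrivialDivisor i<p i∣n))
    where
    i<p : suc (suc i) < p
    i<p = ℕₚ.≤-<-trans (∣⇒≤ {{ℕ.>-nonZero 0<d}} i∣d) d<p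

  coprime-factorial : ∀ {j} → j < p → Coprime n (j !)
  coprime-factorial {zero}  _   (_ , i∣1) = ∣1⇒≡1 i∣1
  coprime-factorial {suc j} j<p =
    coprime-* (coprime-below (s≤s z≤n) j<p) (coprime-factorial (ℕₚ.<-trans (ℕₚ.n<1+n j) j<p))

cofactor< : ∀ {p q n} → 1 < p → p * q ≡ suc n → q < suc n
cofactor< {p} {zero}  _   pq≡n = ⊥-elim (ℕₚ.0≢1+n (trans (sym (ℕₚ.*-zeroʳ p)) pq≡n))
cofactor< {p} {suc q} 1<p pq≡n = subst (suc q <_) (trans (ℕₚ.*-comm (suc q) p) pq≡n) (ℕₚ.m<m*n (suc q) p 1<p)

-- The hypotheses p ∣ n and 2 ≤ r are unused: the case r = p supplies p * k ≡ n itself, and β ≡ 0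
-- also holds for r < 2.
theorem1p1 : (m p r : ℕ) → Prime p → p ∣ suc (2 * m)
    → ((q : ℕ) → Prime q → q ∣ suc (2 * m) → p ≤ q) → 2 ≤ r
    → (r < p → α m r % suc (2 * m) ≡ 0 % suc (2 * m))
    × ((k : ℕ) → p * k ≡ suc (2 * m) → r ≡ p → α m r % suc (2 * m) ≡ k % suc (2 * m))
theorem1p1 m p r p-prime _ p≤prime-divisors _ = r<p⇒α≡0 , r≡p⇒α≡cofactor
  where
  r<p⇒α≡0 : r < p → α m r % suc (2 * m) ≡ 0 % suc (2 * m)
  r<p⇒α≡0 r<p = cong (_% suc (2 * m))
    (≡-mod⇒%ℕ≡ (s≤s z≤n) (β≡0 m r (coprime-factorial p≤prime-divisors r<p)))
  r≡p⇒α≡cofactor : ∀ q → p * q ≡ suc (2 * m) → r ≡ p → α m r % suc (2 * m) ≡ q % suc (2 * m)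
  r≡p⇒α≡cofactor q pq≡n refl = cong (_% suc (2 * m))
    (≡-mod⇒%ℕ≡ (cofactor< (ℕ.nonTrivial⇒n>1 p {{prime⇒nonTrivial p-prime}}) pq≡n)
      (β≡cofactor m p q pq≡n (coprime-factorial p≤prime-divisors p-1<p)))
    where
    p-1<p : ℕ.pred p < p
    p-1<p = ℕₚ.≤-reflexive (ℕₚ.suc-pred p {{prime⇒nonZero p-prime}})
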